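{- Let $s\ge 1$ and $t\ge 1$ be integers. Then $\chi_p(P_{3t}\Diamond_3 C_{4s+3})\le 4$ if $1\le t\le 2$, and $\chi_p(P_{3t}\Diamond_3 C_{4s+3})\le 5$ if $t\ge 3$. Moreover, equality holds for $t\in\{1,2\}$.
   Context: A packing $k$-coloring of a graph $H$ is a map $c:V(H)\to\{1,\ldots,k\}$ such that any two distinct vertices $u,v$ with $c(u)=c(v)=i$ satisfy $d_H(u,v)\ge i+1$. The packing chromatic number $\chi_p(H)$ is the least such $k$. $P_m$ denotes the path $v_1\cdots v_m$ and $C_n$ the cycle on $n$ vertices. Path-aligned product: for positive integers $\ell\mid m$ and a connected vertex-transitive graph $G$ containing $P_\ell$ as a subgraph, $P_m\Diamond_\ell G$ is formed from the path $P_m=v_1\cdots v_m$ and $m/\ell$ pairwise disjoint copies of $G$, where for each $1\le i\le m/\ell$ the consecutive path vertices $v_{(i-1)\ell+1},\ldots,v_{i\ell}$ are identified, in order, with the vertices of a path $P_\ell$ (i.e. $\ell$ consecutive cycle vertices when $G$ is a cycle) in the $i$-th copy of $G$. -}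

module Defs where

open import Data.Nat using (ℕ; zero; suc; _+_; _*_; _≤_; _<_; NonZero)
open import Data.Nat.DivMod using (_/_; _%_)
open import Data.Fin using (Fin; toℕ)
open import Data.Product using (Σ; _×_; _,_; ∃)
open import Relation.Binary.PropositionalEquality using (_≡_)
open import Relation.Nullary using (¬_)

record Graph : Set₁ where
  field
    V   : Set
    Adj : V → V → Set
open Graph public

data Walk (G : Graph) : ℕ → V G → V G → Set where
  here : ∀ {u} → Walk G zero u u
  step : ∀ {k u w v} → Adj G u w → Walk G k w v → Walk G (suc k) u v

DistLe : (G : Graph) → ℕ → V G → V G → Set
DistLe G k u v = Σ ℕ λ j → j ≤ k × Walk G j u v

-- A packing k-colouring; colour c u ∈ Fin k stands for the colour toℕ (c u) + 1 ∈ {1,…,k}.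
-- Two distinct vertices of colour i must satisfy d(u,v) ≥ i+1, i.e. not d(u,v) ≤ i.
IsPackingColoring : (G : Graph) (k : ℕ) → (V G → Fin k) → Set
IsPackingColoring G k c =
  ∀ u v → ¬ (u ≡ v) → c u ≡ c v → ¬ DistLe G (suc (toℕ (c u))) u v

PackingColorable : Graph → ℕ → Set
PackingColorable G k = Σ (V G → Fin k) λ c → IsPackingColoring G k c

PackingChromaticNumber : Graph → ℕ → Set
PackingChromaticNumber G k =
  PackingColorable G k × (∀ j → j < k → ¬ PackingColorable G j)

-- Vertex (i , j) is cycle vertex j of the i-th copy
-- (0-indexed).  Cycle vertices 0,…,ℓ-1 of copy i are the path vertices
-- v_{iℓ+1},…,v_{iℓ+ℓ}; the only path edges not inside a copy join
-- v_{(i+1)ℓ} = (i , ℓ-1) with v_{(i+1)ℓ+1} = (i+1 , 0).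
data DiamondAdj (c ℓ n : ℕ) .{{_ : NonZero n}} : Fin c × Fin n → Fin c × Fin n → Set where
  cyc+  : ∀ {i j j'} → toℕ j' ≡ (suc (toℕ j)) % n → DiamondAdj c ℓ n (i , j) (i , j')
  cyc-  : ∀ {i j j'} → toℕ j ≡ (suc (toℕ j')) % n → DiamondAdj c ℓ n (i , j) (i , j')
  path+ : ∀ {i i' j j'} → toℕ i' ≡ suc (toℕ i) → suc (toℕ j) ≡ ℓ → toℕ j' ≡ 0
          → DiamondAdj c ℓ n (i , j) (i' , j')
  path- : ∀ {i i' j j'} → toℕ i ≡ suc (toℕ i') → suc (toℕ j') ≡ ℓ → toℕ j ≡ 0
          → DiamondAdj c ℓ n (i , j) (i' , j')

-- The path-aligned product P_m ◇_ℓ C_n  (with ℓ ∣ m, ℓ ≤ n, n ≥ 3 assumed by users).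
PDiamondC : (m ℓ n : ℕ) .{{_ : NonZero ℓ}} .{{_ : NonZero n}} → Graph
PDiamondC m ℓ n = record { V = Fin (m / ℓ) × Fin n ; Adj = DiamondAdj (m / ℓ) ℓ n }

{-# OPTIONS --safe #-}
module Submission where

-- Colour every copy of C_{4s+3}, starting from its first path vertex, with the packing
-- colouring 1 2 1 3 1 2 1 3 … of a path, shifted by one place in the copies of even index,
-- and give its last vertex colour 4; in the even copies other than copy 0 the first path
-- vertex gets colour 5 instead, so colour 5 is needed only when t ≥ 3.  Every bridge is a
-- cut edge, so a walk between two copies crosses all the bridges in between, and retracting
-- it onto single cycles bounds its length below by cycle distances; near each bridge and
-- near the seam of each cycle the colouring looks the same for all s, by 4-periodicity.
-- Conversely, with three colours the vertices of colour 1 would have to alternate around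
-- each cycle, which is impossible on an odd cycle.

open import Defs
open import Data.Bool using (Bool; not)
open import Data.Bool.Properties using (not-¬; not-involutive)
open import Data.Empty using (⊥; ⊥-elim)
open import Data.Fin using (Fin; toℕ; fromℕ<)
open import Data.Fin.Properties using (toℕ<n; toℕ-injective; toℕ-fromℕ<; fromℕ<-cong)
open import Data.Nat using (ℕ; zero; suc; _+_; _*_; _≤_; _<_; z≤n; s≤s; NonZero; _≟_; _≤?_; _≡ᵇ_; >-nonZero⁻¹)
open import Data.Nat.DivMod using (_%_; _/_; m%n<n; m<n⇒m%n≡m; n%n≡0; m*n/n≡m)
open import Data.Nat.GeneralisedArithmetic using (iterate)
open import Data.Nat.Properties
open import Algebra.Properties.CommutativeSemigroup +-commutativeSemigroup using (x∙yz≈y∙xz)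
open import Data.Nat.Tactic.RingSolver using (solve-∀)
open import Data.Product using (∃-syntax; _×_; _,_; proj₁; proj₂)
open import Data.Sum using (_⊎_; inj₁; inj₂; map)
open import Function using (_∘_; flip)
open import Relation.Binary using (tri<; tri≈; tri>)
open import Relation.Binary.PropositionalEquality
open import Relation.Nullary using (¬_; yes; no; Dec; ¬?)
open import Relation.Nullary.Decidable using (from-yes; _⊎-dec_; _→-dec_)

-- Distances on a cycle

iterate-suc : ∀ {A : Set} (f : A → A) x d → iterate f x (suc d) ≡ f (iterate f x d)
iterate-suc f x zero    = refl
iterate-suc f x (suc d) = iterate-suc f (f x) d

iterate-+ : ∀ {A : Set} (f : A → A) x d e → iterate f x (d + e) ≡ iterate f (iterate f x d) e
iterate-+ f x zero    e = refl
iterate-+ f x (suc d) e = iterate-+ f (f x) d e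

Arc : ℕ → ℕ → ℕ → ℕ → Set
Arc n d a b = a + d ≡ b ⊎ a + d ≡ b + n

module _ (n : ℕ) .{{_ : NonZero n}} where

  cycleSuc : ℕ → ℕ
  cycleSuc x = suc x % n

  CycleStep : ℕ → ℕ → Set
  CycleStep x y = y ≡ cycleSuc x ⊎ x ≡ cycleSuc y ⊎ x ≡ y

  CycleDist≤ : ℕ → ℕ → ℕ → Set
  CycleDist≤ k a b = ∃[ d ] d ≤ k × (iterate cycleSuc a d ≡ b ⊎ iterate cycleSuc b d ≡ a)

module _ {n : ℕ} .{{_ : NonZero n}} where

  cycleSuc<n : ∀ x → cycleSuc n x < n
  cycleSuc<n x = m%n<n (suc x) n

  cycleSuc-cases : ∀ {x} → x < n → cycleSuc n x ≡ suc x ⊎ suc x ≡ n × cycleSuc n x ≡ 0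
  cycleSuc-cases x<n with m≤n⇒m<n∨m≡n x<n
  ... | inj₁ 1+x<n = inj₁ (m<n⇒m%n≡m 1+x<n)
  ... | inj₂ refl  = inj₂ (refl , n%n≡0 n)

  cycleSuc-injective : ∀ {x y} → x < n → y < n → cycleSuc n x ≡ cycleSuc n y → x ≡ y
  cycleSuc-injective x<n y<n eq with cycleSuc-cases x<n | cycleSuc-cases y<n
  ... | inj₁ ex       | inj₁ ey       = suc-injective (trans (sym ex) (trans eq ey))
  ... | inj₁ ex       | inj₂ (_ , ey) with () ← trans (sym ex) (trans eq ey)
  ... | inj₂ (_ , ex) | inj₁ ey       with () ← trans (sym ey) (trans (sym eq) ex)
  ... | inj₂ (nx , _) | inj₂ (ny , _) = suc-injective (trans nx (sym ny))

  iterate<n : ∀ {a} → a < n → ∀ d → iterate (cycleSuc n) a d < n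
  iterate<n a<n zero    = a<n
  iterate<n a<n (suc d) = iterate<n (cycleSuc<n _) d

  cycleDist-refl : ∀ a → CycleDist≤ n 0 a a
  cycleDist-refl a = 0 , z≤n , inj₁ refl

  cycleDist-sym : ∀ {k a b} → CycleDist≤ n k a b → CycleDist≤ n k b a
  cycleDist-sym (d , d≤k , inj₁ p) = d , d≤k , inj₂ p
  cycleDist-sym (d , d≤k , inj₂ p) = d , d≤k , inj₁ p

  cycleDist-step : ∀ {k x y z} → x < n → z < n → CycleStep n x y → CycleDist≤ n k y z → CycleDist≤ n (suc k) x z
  cycleDist-step _ _ (inj₁ refl) (d , d≤k , inj₁ p)     = suc d , s≤s d≤k , inj₁ p
  cycleDist-step _ _ (inj₁ refl) (zero , _ , inj₂ refl) = 1 , s≤s z≤n , inj₁ refl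
  cycleDist-step {z = z} x<n z<n (inj₁ refl) (suc d , 1+d≤k , inj₂ p) =
    d , m<n⇒m≤1+n 1+d≤k ,
    inj₂ (cycleSuc-injective (iterate<n z<n d) x<n (trans (sym (iterate-suc (cycleSuc n) z d)) p))
  cycleDist-step _ _ (inj₂ (inj₁ refl)) (zero , _ , inj₁ refl)       = 1 , s≤s z≤n , inj₂ refl
  cycleDist-step _ _ (inj₂ (inj₁ refl)) (suc d , 1+d≤k , inj₁ p)     = d , m<n⇒m≤1+n 1+d≤k , inj₁ p
  cycleDist-step {z = z} _ _ (inj₂ (inj₁ refl)) (d , d≤k , inj₂ p) =
    suc d , s≤s d≤k , inj₂ (trans (iterate-suc (cycleSuc n) z d) (cong (cycleSuc n) p))
  cycleDist-step _ _ (inj₂ (inj₂ refl)) (d , d≤k , p) = d , m≤n⇒m≤1+n d≤k , p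

  arc-cons : ∀ {a b d} → a < n → suc d ≤ n → Arc n d (cycleSuc n a) b → Arc n (suc d) a b
  arc-cons {a} {b} {d} a<n 1+d≤n arc with cycleSuc-cases a<n
  ... | inj₁ eq = map (trans (+-suc a d)) (trans (+-suc a d)) (subst (λ x → Arc n d x b) eq arc)
  ... | inj₂ (1+a≡n , eq) with subst (λ x → Arc n d x b) eq arc
  ...   | inj₁ d≡b = inj₂ (begin
            a + suc d ≡⟨ +-suc a d ⟩
            suc a + d ≡⟨ cong₂ _+_ 1+a≡n d≡b ⟩
            n + b     ≡⟨ +-comm n b ⟩
            b + n     ∎)
          where open ≡-Reasoning
  ...   | inj₂ d≡b+n = ⊥-elim (<⇒≱ 1+d≤n (subst (n ≤_) (sym d≡b+n) (m≤n+m n b)))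

  iterate-arc : ∀ {a} → a < n → ∀ d → d ≤ n → Arc n d a (iterate (cycleSuc n) a d)
  iterate-arc {a} _   zero    _     = inj₁ (+-identityʳ a)
  iterate-arc     a<n (suc d) 1+d≤n = arc-cons a<n 1+d≤n (iterate-arc (cycleSuc<n _) d (<⇒≤ 1+d≤n))

  iterate-full-turn : ∀ {a} → a < n → iterate (cycleSuc n) a n ≡ a
  iterate-full-turn {a} a<n with iterate-arc a<n n ≤-refl
  ... | inj₁ a+n≡b   = ⊥-elim (<⇒≱ (iterate<n a<n n) (subst (n ≤_) a+n≡b (m≤n+m n a)))
  ... | inj₂ a+n≡b+n = sym (+-cancelʳ-≡ n a _ a+n≡b+n)

  cycleDist-arc : ∀ {k a b} → a < n → b < n → k ≤ n → CycleDist≤ n k a b →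
                  ∃[ d ] d ≤ k × (Arc n d a b ⊎ Arc n d b a)
  cycleDist-arc a<n _ k≤n (d , d≤k , inj₁ refl) = d , d≤k , inj₁ (iterate-arc a<n d (≤-trans d≤k k≤n))
  cycleDist-arc _ b<n k≤n (d , d≤k , inj₂ refl) = d , d≤k , inj₂ (iterate-arc b<n d (≤-trans d≤k k≤n))

  cycleDist-≥ : ∀ {k a b δ} → b < n → a + δ ≤ b → b + δ ≤ a + n → CycleDist≤ n k a b → δ ≤ k
  cycleDist-≥ {k} {a} {b} {δ} b<n a+δ≤b b+δ≤a+n dist with k ≤? n
  ... | no k≰n =
    ≤-trans (+-cancelˡ-≤ b δ n (≤-trans b+δ≤a+n (+-monoˡ-≤ n (m+n≤o⇒m≤o a a+δ≤b)))) (<⇒≤ (≰⇒> k≰n))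
  ... | yes k≤n with cycleDist-arc (≤-<-trans (m+n≤o⇒m≤o a a+δ≤b) b<n) b<n k≤n dist
  ...   | d , d≤k , arc = ≤-trans (δ≤d arc) d≤k
    where
    δ≤d : Arc n d a b ⊎ Arc n d b a → δ ≤ d
    δ≤d (inj₁ (inj₁ a+d≡b))   = +-cancelˡ-≤ a δ d (≤-trans a+δ≤b (≤-reflexive (sym a+d≡b)))
    δ≤d (inj₁ (inj₂ a+d≡b+n)) =
      +-cancelˡ-≤ a δ d (≤-trans a+δ≤b (≤-trans (m≤m+n b n) (≤-reflexive (sym a+d≡b+n))))
    δ≤d (inj₂ (inj₁ b+d≡a))   =
      +-cancelˡ-≤ a δ d (≤-trans a+δ≤b (≤-trans (m≤m+n b d) (≤-trans (≤-reflexive b+d≡a) (m≤m+n a d))))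
    δ≤d (inj₂ (inj₂ b+d≡a+n)) = +-cancelˡ-≤ b δ d (≤-trans b+δ≤a+n (≤-reflexive (sym b+d≡a+n)))

arc-zero : ∀ {n a b} → a < n → Arc n 0 a b → a ≡ b
arc-zero {a = a} _ (inj₁ a+0≡b) = trans (sym (+-identityʳ a)) a+0≡b
arc-zero {n} {a} {b} a<n (inj₂ a+0≡b+n) =
  ⊥-elim (<⇒≱ a<n (≤-trans (m≤n+m n b) (≤-reflexive (trans (sym a+0≡b+n) (+-identityʳ a)))))

-- Walks in a necklace of cycles

walk-snoc : ∀ {G k u v w} → Walk G k u v → Adj G v w → Walk G (suc k) u w
walk-snoc here         e = step e here
walk-snoc (step e′ ws) e = step e′ (walk-snoc ws e)

walk-reverse : ∀ {G} → (∀ {u v} → Adj G u v → Adj G v u) → ∀ {k u v} → Walk G k u v → Walk G k v u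
walk-reverse sym-adj here        = here
walk-reverse sym-adj (step e ws) = walk-snoc (walk-reverse sym-adj ws) (sym-adj e)

diamondAdj-sym : ∀ {c ℓ n} .{{_ : NonZero n}} {u v} → DiamondAdj c ℓ n u v → DiamondAdj c ℓ n v u
diamondAdj-sym (cyc+ e)        = cyc- e
diamondAdj-sym (cyc- e)        = cyc+ e
diamondAdj-sym (path+ e e′ e″) = path- e e′ e″
diamondAdj-sym (path- e e′ e″) = path+ e e′ e″

-- PDiamondC m 3 n is definitionally Necklace (m / 3) n.
Necklace : (c n : ℕ) .{{_ : NonZero n}} → Graph
Necklace c n = record { V = Fin c × Fin n ; Adj = DiamondAdj c 3 n }

copy : ∀ {c n} → Fin c × Fin n → ℕ
copy = toℕ ∘ proj₁

pos : ∀ {c n} → Fin c × Fin n → ℕ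
pos = toℕ ∘ proj₂

-- Seen from copy p, the earlier copies collapse onto its vertex 0 and the later ones onto
-- its vertex 2, so that every edge becomes a cycle edge or a loop.
retract : ℕ → ℕ → ℕ → ℕ
retract p i j with <-cmp i p
... | tri< _ _ _ = 0
... | tri≈ _ _ _ = j
... | tri> _ _ _ = 2

retract-here : ∀ {p i} j → i ≡ p → retract p i j ≡ j
retract-here {p} {i} j i≡p with <-cmp i p
... | tri< _ i≢p _ = ⊥-elim (i≢p i≡p)
... | tri≈ _ _ _   = refl
... | tri> _ i≢p _ = ⊥-elim (i≢p i≡p)

retract<n : ∀ {n} p i {j} → 3 ≤ n → j < n → retract p i j < n
retract<n p i 3≤n j<n with <-cmp i p
... | tri< _ _ _ = ≤-trans (s≤s z≤n) 3≤n
... | tri≈ _ _ _ = j<n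
... | tri> _ _ _ = 3≤n

retract-bridge : ∀ p i → retract p i 2 ≡ retract p (suc i) 0
retract-bridge p i with <-cmp i p | <-cmp (suc i) p
... | tri< _ _ _   | tri< _ _ _     = refl
... | tri< _ _ _   | tri≈ _ _ _     = refl
... | tri< i<p _ _ | tri> _ _ p<1+i = ⊥-elim (<⇒≱ i<p (≤-pred p<1+i))
... | tri≈ _ _ _   | tri> _ _ _     = refl
... | tri> _ _ _   | tri> _ _ _     = refl
... | tri≈ i≮p _ _ | tri< 1+i<p _ _ = ⊥-elim (i≮p (<-trans (n<1+n i) 1+i<p))
... | tri≈ i≮p _ _ | tri≈ _ 1+i≡p _ = ⊥-elim (i≮p (subst (i <_) 1+i≡p (n<1+n i)))
... | tri> i≮p _ _ | tri< 1+i<p _ _ = ⊥-elim (i≮p (<-trans (n<1+n i) 1+i<p))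
... | tri> i≮p _ _ | tri≈ _ 1+i≡p _ = ⊥-elim (i≮p (subst (i <_) 1+i≡p (n<1+n i)))

module _ {c n : ℕ} .{{_ : NonZero n}} where

  retract-within : ∀ p i {j j′} → CycleStep n j j′ → CycleStep n (retract p i j) (retract p i j′)
  retract-within p i j~j′ with <-cmp i p
  ... | tri< _ _ _ = inj₂ (inj₂ refl)
  ... | tri≈ _ _ _ = j~j′
  ... | tri> _ _ _ = inj₂ (inj₂ refl)

  retract-adj : ∀ p {u w : Fin c × Fin n} → DiamondAdj c 3 n u w →
                CycleStep n (retract p (copy u) (pos u)) (retract p (copy w) (pos w))
  retract-adj p (cyc+ e) = retract-within p _ (inj₁ e)
  retract-adj p (cyc- e) = retract-within p _ (inj₂ (inj₁ e))
  retract-adj p (path+ {i} i′≡1+i 1+j≡3 j′≡0)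
    rewrite i′≡1+i | j′≡0 | suc-injective 1+j≡3 = inj₂ (inj₂ (retract-bridge p (toℕ i)))
  retract-adj p (path- {_} {i′} i≡1+i′ 1+j′≡3 j≡0)
    rewrite i≡1+i′ | j≡0 | suc-injective 1+j′≡3 = inj₂ (inj₂ (sym (retract-bridge p (toℕ i′))))

  walk-retract : 3 ≤ n → ∀ p {k u v} → Walk (Necklace c n) k u v →
                 CycleDist≤ n k (retract p (copy u) (pos u)) (retract p (copy v) (pos v))
  walk-retract 3≤n p {u = i , j} here = cycleDist-refl (retract p (toℕ i) (toℕ j))
  walk-retract 3≤n p {u = i , j} {v = i′ , j′} (step e ws) =
    cycleDist-step (retract<n p (toℕ i) 3≤n (toℕ<n j)) (retract<n p (toℕ i′) 3≤n (toℕ<n j′))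
                   (retract-adj p e) (walk-retract 3≤n p ws)

  walk-in-copy : 3 ≤ n → ∀ {k} {u v : Fin c × Fin n} → copy u ≡ copy v → Walk (Necklace c n) k u v →
                 CycleDist≤ n k (pos u) (pos v)
  walk-in-copy 3≤n {u = u} {v} u~v ws =
    subst₂ (CycleDist≤ n _) (retract-here (pos u) refl) (retract-here (pos v) (sym u~v))
           (walk-retract 3≤n (copy u) ws)

  record Crossing (p k : ℕ) (u v : Fin c × Fin n) : Set where
    field
      before after : ℕ
      lengths      : before + suc after ≡ k
      exit entry   : Fin c × Fin n
      exit-copy    : copy exit ≡ p
      exit-pos     : pos exit ≡ 2
      entry-copy   : copy entry ≡ suc p
      entry-pos    : pos entry ≡ 0
      walk-before  : Walk (Necklace c n) before u exit
      walk-after   : Walk (Necklace c n) after entry v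

  crossing-cons : ∀ {p k u w v} → DiamondAdj c 3 n u w → Crossing p k w v → Crossing p (suc k) u v
  crossing-cons e x = record
    { X ; before = suc X.before ; lengths = cong suc X.lengths ; walk-before = step e X.walk-before }
    where module X = Crossing x

  crossing : ∀ p {k} {u v : Fin c × Fin n} → copy u ≤ p → p < copy v → Walk (Necklace c n) k u v → Crossing p k u v
  crossing p u≤p p<v here = ⊥-elim (<⇒≱ p<v u≤p)
  crossing p u≤p p<v (step e@(cyc+ _) ws) = crossing-cons e (crossing p u≤p p<v ws)
  crossing p u≤p p<v (step e@(cyc- _) ws) = crossing-cons e (crossing p u≤p p<v ws)
  crossing p u≤p p<v (step e@(path- i≡1+i′ _ _) ws) =
    crossing-cons e (crossing p (≤-trans (≤-trans (n≤1+n _) (≤-reflexive (sym i≡1+i′))) u≤p) p<v ws)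
  crossing p {u = u} u≤p p<v (step {w = w} e@(path+ i′≡1+i 1+j≡3 j′≡0) ws) with m≤n⇒m<n∨m≡n u≤p
  ... | inj₁ u<p = crossing-cons e (crossing p (subst (_≤ p) (sym i′≡1+i) u<p) p<v ws)
  ... | inj₂ u≡p = record
    { before = 0 ; after = _ ; lengths = refl ; exit = u ; entry = w
    ; exit-copy = u≡p ; exit-pos = suc-injective 1+j≡3 ; entry-copy = trans i′≡1+i (cong suc u≡p) ; entry-pos = j′≡0
    ; walk-before = here ; walk-after = ws }

  mutual
    walk-forward : 4 ≤ n → ∀ g {k} {u v : Fin c × Fin n} → copy v ≡ g + copy u → pos u ≡ 0 →
                   Walk (Necklace c n) k u v → ∃[ k′ ] 3 * g + k′ ≤ k × CycleDist≤ n k′ 0 (pos v)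
    walk-forward 4≤n zero {k} {v = v} v~u u₀ ws =
      k , ≤-refl , subst (λ x → CycleDist≤ n k x (pos v)) u₀ (walk-in-copy (≤-trans (n≤1+n 3) 4≤n) (sym v~u) ws)
    walk-forward 4≤n (suc g) {k} v~u u₀ ws with walk-across 4≤n g v~u ws
    ... | k₁ , k₂ , len , dist₁ , dist₂ =
      k₂ , subst (_≤ k) (sym (cong (_+ k₂) (*-suc 3 g))) (≤-trans (+-monoˡ-≤ _ 2≤k₁) len) , dist₂
      where
      2≤k₁ : 2 ≤ k₁
      2≤k₁ = cycleDist-≥ (≤-trans (n≤1+n 3) 4≤n) ≤-refl 4≤n (subst (λ x → CycleDist≤ n k₁ x 2) u₀ dist₁)

    walk-across : 4 ≤ n → ∀ g {k} {u v : Fin c × Fin n} → copy v ≡ suc (g + copy u) → Walk (Necklace c n) k u v →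
                  ∃[ k₁ ] ∃[ k₂ ] k₁ + suc (3 * g + k₂) ≤ k ×
                                  CycleDist≤ n k₁ (pos u) 2 × CycleDist≤ n k₂ 0 (pos v)
    walk-across 4≤n g {u = u} {v} v~u ws
      with crossing (copy u) ≤-refl (subst (copy u <_) (sym v~u) (s≤s (m≤n+m (copy u) g))) ws
    ... | record { lengths = refl ; exit-copy = exit-copy ; exit-pos = exit-pos ; entry-copy = entry-copy
                 ; entry-pos = entry-pos ; walk-before = walk-before ; walk-after = walk-after }
      with walk-forward 4≤n g (trans v~u (trans (sym (+-suc g _)) (cong (g +_) (sym entry-copy)))) entry-pos walk-after
    ... | k′ , 3g+k′≤ , dist₂ =
      _ , k′ , +-monoʳ-≤ _ (s≤s 3g+k′≤) ,
      subst (CycleDist≤ n _ (pos u)) exit-pos (walk-in-copy (≤-trans (n≤1+n 3) 4≤n) (sym exit-copy) walk-before) ,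
      dist₂

-- Three colours do not suffice

PackingSequence : (ℕ → ℕ) → Set
PackingSequence F = ∀ x d → 1 ≤ d → d ≤ suc (F x) → F x ≢ F (d + x)

module _ (F : ℕ → ℕ) (F<3 : ∀ x → F x < 3) (packing : PackingSequence F) where

  private
    Colour3 : ℕ → Set
    Colour3 x = F x ≡ 0 ⊎ F x ≡ 1 ⊎ F x ≡ 2

    colour3 : ∀ x → Colour3 x
    colour3 x with F x | F<3 x
    ... | 0 | _ = inj₁ refl
    ... | 1 | _ = inj₂ (inj₁ refl)
    ... | 2 | _ = inj₂ (inj₂ refl)
    ... | suc (suc (suc _)) | s≤s (s≤s (s≤s ()))

    clash : ∀ {x c} d → F x ≡ c → F (d + x) ≡ c → 1 ≤ d → d ≤ suc c → ⊥
    clash {x} d refl eq 1≤d d≤ = packing x d 1≤d d≤ (sym eq)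

    no-adjacent-nonzero : ∀ y {a b} → F (2 + y) ≡ suc a → F (3 + y) ≡ suc b → ⊥
    no-adjacent-nonzero y nz₂ nz₃ with colour3 (2 + y) | colour3 (3 + y)
    ... | inj₁ e₂ | _ with () ← trans (sym nz₂) e₂
    ... | _ | inj₁ e₃ with () ← trans (sym nz₃) e₃
    ... | inj₂ (inj₁ e₂) | inj₂ (inj₁ e₃) = clash 1 e₂ e₃ (s≤s z≤n) (s≤s z≤n)
    ... | inj₂ (inj₂ e₂) | inj₂ (inj₂ e₃) = clash 1 e₂ e₃ (s≤s z≤n) (s≤s z≤n)
    ... | inj₂ (inj₁ e₂) | inj₂ (inj₂ e₃) = look-back (colour3 (1 + y)) (colour3 y)
      where
      look-back : Colour3 (1 + y) → Colour3 y → ⊥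
      look-back (inj₂ (inj₁ e₁)) _         = clash 1 e₁ e₂ (s≤s z≤n) (s≤s z≤n)
      look-back (inj₂ (inj₂ e₁)) _         = clash 2 e₁ e₃ (s≤s z≤n) (s≤s (s≤s z≤n))
      look-back (inj₁ e₁) (inj₁ e₀)        = clash 1 e₀ e₁ (s≤s z≤n) (s≤s z≤n)
      look-back (inj₁ _)  (inj₂ (inj₁ e₀)) = clash 2 e₀ e₂ (s≤s z≤n) ≤-refl
      look-back (inj₁ _)  (inj₂ (inj₂ e₀)) = clash 3 e₀ e₃ (s≤s z≤n) ≤-refl
    ... | inj₂ (inj₂ e₂) | inj₂ (inj₁ e₃) = look-ahead (colour3 (4 + y)) (colour3 (5 + y))
      where
      look-ahead : Colour3 (4 + y) → Colour3 (5 + y) → ⊥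
      look-ahead (inj₂ (inj₁ e₄)) _         = clash 1 e₃ e₄ (s≤s z≤n) (s≤s z≤n)
      look-ahead (inj₂ (inj₂ e₄)) _         = clash 2 e₂ e₄ (s≤s z≤n) (s≤s (s≤s z≤n))
      look-ahead (inj₁ e₄) (inj₁ e₅)        = clash 1 e₄ e₅ (s≤s z≤n) (s≤s z≤n)
      look-ahead (inj₁ _)  (inj₂ (inj₁ e₅)) = clash 2 e₃ e₅ (s≤s z≤n) ≤-refl
      look-ahead (inj₁ _)  (inj₂ (inj₂ e₅)) = clash 3 e₂ e₅ (s≤s z≤n) ≤-refl

    zero? : ℕ → Bool
    zero? x = F x ≡ᵇ 0

    zero?-alternates : ∀ y → zero? (3 + y) ≡ not (zero? (2 + y))
    zero?-alternates y with F (2 + y) in e₂ | F (3 + y) in e₃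
    ... | zero  | zero  = ⊥-elim (clash 1 e₂ e₃ (s≤s z≤n) (s≤s z≤n))
    ... | zero  | suc _ = refl
    ... | suc _ | zero  = refl
    ... | suc _ | suc _ = ⊥-elim (no-adjacent-nonzero y e₂ e₃)

    zero?-even-shift : ∀ j → zero? (2 + j * 2) ≡ zero? 2
    zero?-even-shift zero    = refl
    zero?-even-shift (suc j) = begin
      zero? (3 + suc (j * 2))       ≡⟨ zero?-alternates (suc (j * 2)) ⟩
      not (zero? (3 + j * 2))       ≡⟨ cong not (zero?-alternates (j * 2)) ⟩
      not (not (zero? (2 + j * 2))) ≡⟨ not-involutive _ ⟩
      zero? (2 + j * 2)             ≡⟨ zero?-even-shift j ⟩
      zero? 2                       ∎
      where open ≡-Reasoning

  no-odd-period : ∀ j → ¬ (∀ x → F (suc (j * 2) + x) ≡ F x)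
  no-odd-period j periodic = not-¬ refl (begin
    zero? 2                 ≡⟨ cong (_≡ᵇ 0) (sym (periodic 2)) ⟩
    zero? (suc (j * 2) + 2) ≡⟨ cong zero? (+-comm (suc (j * 2)) 2) ⟩
    zero? (3 + j * 2)       ≡⟨ zero?-alternates (j * 2) ⟩
    not (zero? (2 + j * 2)) ≡⟨ cong not (zero?-even-shift j) ⟩
    not (zero? 2)           ∎)
    where open ≡-Reasoning

module _ {n : ℕ} .{{_ : NonZero n}} where

  around : ℕ → ℕ
  around = iterate (cycleSuc n) 0

  around<n : ∀ x → around x < n
  around<n = iterate<n (>-nonZero⁻¹ n)

  around-periodic : ∀ x → around (n + x) ≡ around x
  around-periodic x =
    trans (iterate-+ (cycleSuc n) 0 n x) (cong (λ a → iterate (cycleSuc n) a x) (iterate-full-turn (>-nonZero⁻¹ n)))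

  around-short-injective : ∀ x d → 1 ≤ d → d < n → around x ≢ around (d + x)
  around-short-injective x d 1≤d d<n eq with subst (Arc n d (around x)) shifted (iterate-arc (around<n x) d (<⇒≤ d<n))
    where
    shifted : iterate (cycleSuc n) (around x) d ≡ around x
    shifted = trans (sym (iterate-+ (cycleSuc n) 0 x d)) (trans (cong around (+-comm x d)) (sym eq))
  ... | inj₁ a+d≡a   = <⇒≢ 1≤d (sym (+-cancelˡ-≡ (around x) d 0 (trans a+d≡a (sym (+-identityʳ _)))))
  ... | inj₂ a+d≡a+n = <⇒≢ d<n (+-cancelˡ-≡ (around x) d n a+d≡a+n)

module _ {c n : ℕ} .{{_ : NonZero n}} where

  vertexAt : Fin c → ℕ → Fin c × Fin n
  vertexAt z x = z , fromℕ< (around<n x)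

  walk-around : ∀ z k x → Walk (Necklace c n) k (vertexAt z x) (vertexAt z (k + x))
  walk-around z zero    x = here
  walk-around z (suc k) x = walk-snoc (walk-around z k x) (cyc+ (begin
    toℕ (fromℕ< (around<n (suc k + x)))          ≡⟨ toℕ-fromℕ< _ ⟩
    around (suc (k + x))                         ≡⟨ iterate-suc (cycleSuc n) 0 (k + x) ⟩
    cycleSuc n (around (k + x))                  ≡⟨ cong (cycleSuc n) (sym (toℕ-fromℕ< _)) ⟩
    cycleSuc n (toℕ (fromℕ< (around<n (k + x)))) ∎))
    where open ≡-Reasoning

odd-necklace-not-3-colorable : ∀ {c n} .{{_ : NonZero n}} j → n ≡ suc (j * 2) → 2 ≤ j → Fin c →
                               ∀ {k} → k ≤ 3 → ¬ PackingColorable (Necklace c n) k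
odd-necklace-not-3-colorable j refl 2≤j z k≤3 (col , ok) = no-odd-period F F<3 packing j periodic
  where
  F : ℕ → ℕ
  F x = toℕ (col (vertexAt z x))

  F<3 : ∀ x → F x < 3
  F<3 x = ≤-trans (toℕ<n (col (vertexAt z x))) k≤3

  packing : PackingSequence F
  packing x d 1≤d d≤ eq = ok (vertexAt z x) (vertexAt z (d + x)) distinct (toℕ-injective eq) (d , d≤ , walk-around z d x)
    where
    d<n : d < suc (j * 2)
    d<n = ≤-trans (s≤s (≤-trans d≤ (F<3 x))) (≤-trans (n≤1+n 4) (s≤s (*-monoˡ-≤ 2 2≤j)))
    distinct : vertexAt z x ≢ vertexAt z (d + x)
    distinct same = around-short-injective x d 1≤d d<n
      (trans (sym (toℕ-fromℕ< (around<n x))) (trans (cong pos same) (toℕ-fromℕ< (around<n (d + x)))))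

  periodic : ∀ x → F (suc (j * 2) + x) ≡ F x
  periodic x = cong (λ p → toℕ (col (z , p)))
    (fromℕ<-cong _ _ (around-periodic {suc (j * 2)} x) (around<n (suc (j * 2) + x)) (around<n x))

-- The colouring

-- Colours are shifted down by one, as in Defs: stripe is the packing colouring 1 2 1 3 … of a path.
stripe : ℕ → ℕ
stripe 0 = 0
stripe 1 = 1
stripe 2 = 0
stripe 3 = 2
stripe (suc (suc (suc (suc x)))) = stripe x

stripe≤2 : ∀ x → stripe x ≤ 2
stripe≤2 0 = z≤n
stripe≤2 1 = s≤s z≤n
stripe≤2 2 = z≤n
stripe≤2 3 = ≤-refl
stripe≤2 (suc (suc (suc (suc x)))) = stripe≤2 x

stripe≢ : ∀ x {c} → 2 < c → stripe x ≢ c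
stripe≢ x 2<c refl = <⇒≱ 2<c (stripe≤2 x)

stripe-periodic : ∀ q x → stripe (4 * q + x) ≡ stripe x
stripe-periodic q x = trans (cong (λ y → stripe (y + x)) (*-comm 4 q)) (go q)
  where
  go : ∀ q → stripe (q * 4 + x) ≡ stripe x
  go zero    = refl
  go (suc q) = go q

stripe-separated : ∀ x d → 1 ≤ d → d ≤ suc (stripe x) → stripe x ≢ stripe (x + d)
stripe-separated (suc (suc (suc (suc x)))) d = stripe-separated x d
stripe-separated _ 0 ()
stripe-separated 0 1 _ _ ()
stripe-separated 0 (suc (suc _)) _ (s≤s ())
stripe-separated 1 1 _ _ ()
stripe-separated 1 2 _ _ ()
stripe-separated 1 (suc (suc (suc _))) _ (s≤s (s≤s ()))
stripe-separated 2 1 _ _ ()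
stripe-separated 2 (suc (suc _)) _ (s≤s ())
stripe-separated 3 1 _ _ ()
stripe-separated 3 2 _ _ ()
stripe-separated 3 3 _ _ ()
stripe-separated 3 (suc (suc (suc (suc _)))) _ (s≤s (s≤s (s≤s ())))

data Kind : Set where
  initial odd even : Kind

following : Kind → Kind
following initial = odd
following odd     = even
following even    = odd

kind : ℕ → Kind
kind zero    = initial
kind (suc i) = following (kind i)

early-kind≢even : ∀ {i} → i < 2 → kind i ≢ even
early-kind≢even {0} _ ()
early-kind≢even {1} _ ()
early-kind≢even {suc (suc _)} (s≤s (s≤s ()))

following-even : ∀ {κ} → κ ≡ even → following κ ≢ even
following-even refl ()

shift : Kind → ℕ
shift odd = 0
shift _   = 1

shift≤1 : ∀ κ → shift κ ≤ 1
shift≤1 initial = ≤-refl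
shift≤1 odd     = z≤n
shift≤1 even    = ≤-refl

bodyColor : Kind → ℕ → ℕ
bodyColor even zero = 4
bodyColor κ    j    = stripe (shift κ + j)

bodyColor≤4 : ∀ κ j → bodyColor κ j ≤ 4
bodyColor≤4 even    zero    = ≤-refl
bodyColor≤4 even    (suc j) = ≤-trans (stripe≤2 (2 + j)) (m≤m+n 2 2)
bodyColor≤4 odd     j       = ≤-trans (stripe≤2 j) (m≤m+n 2 2)
bodyColor≤4 initial j       = ≤-trans (stripe≤2 (1 + j)) (m≤m+n 2 2)

bodyColor≤3 : ∀ κ j → κ ≢ even → bodyColor κ j ≤ 3
bodyColor≤3 initial j _      = ≤-trans (stripe≤2 (1 + j)) (n≤1+n 2)
bodyColor≤3 odd     j _      = ≤-trans (stripe≤2 j) (n≤1+n 2)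
bodyColor≤3 even    _ κ≢even = ⊥-elim (κ≢even refl)

bodyColor≢3 : ∀ κ j → bodyColor κ j ≢ 3
bodyColor≢3 even    zero    ()
bodyColor≢3 even    (suc j) = stripe≢ (2 + j) ≤-refl
bodyColor≢3 odd     j       = stripe≢ j ≤-refl
bodyColor≢3 initial j       = stripe≢ (1 + j) ≤-refl

bodyColor≡4 : ∀ κ j → bodyColor κ j ≡ 4 → κ ≡ even × j ≡ 0
bodyColor≡4 even    zero    _  = refl , refl
bodyColor≡4 even    (suc j) eq = ⊥-elim (stripe≢ (2 + j) (n≤1+n 3) eq)
bodyColor≡4 odd     j       eq = ⊥-elim (stripe≢ j (n≤1+n 3) eq)
bodyColor≡4 initial j       eq = ⊥-elim (stripe≢ (1 + j) (n≤1+n 3) eq)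

bodyColor≤2 : ∀ κ j → bodyColor κ j ≤ 2 → bodyColor κ j ≡ stripe (shift κ + j)
bodyColor≤2 even    zero    (s≤s (s≤s ()))
bodyColor≤2 even    (suc j) _ = refl
bodyColor≤2 odd     _       _ = refl
bodyColor≤2 initial _       _ = refl

bodyColor-pos : ∀ κ {x} → 1 ≤ x → bodyColor κ x ≡ stripe (shift κ + x)
bodyColor-pos even    (s≤s z≤n) = refl
bodyColor-pos odd     _         = refl
bodyColor-pos initial _         = refl

bodyColor-periodic : ∀ κ q {x} → 1 ≤ x → bodyColor κ (4 * q + x) ≡ bodyColor κ x
bodyColor-periodic κ q {x} 1≤x = begin
  bodyColor κ (4 * q + x)        ≡⟨ bodyColor-pos κ (≤-trans 1≤x (m≤n+m x (4 * q))) ⟩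
  stripe (shift κ + (4 * q + x)) ≡⟨ cong stripe (x∙yz≈y∙xz (shift κ) (4 * q) x) ⟩
  stripe (4 * q + (shift κ + x)) ≡⟨ stripe-periodic q (shift κ + x) ⟩
  stripe (shift κ + x)           ≡⟨ sym (bodyColor-pos κ 1≤x) ⟩
  bodyColor κ x                  ∎
  where open ≡-Reasoning

cycleColor : ℕ → Kind → ℕ → ℕ
cycleColor m κ j with j ≟ m
... | yes _ = 3
... | no  _ = bodyColor κ j

module _ (m : ℕ) (κ : Kind) (j : ℕ) where

  cycleColor≤4 : cycleColor m κ j ≤ 4
  cycleColor≤4 with j ≟ m
  ... | yes _ = n≤1+n 3
  ... | no  _ = bodyColor≤4 κ j

  cycleColor≤3 : κ ≢ even → cycleColor m κ j ≤ 3
  cycleColor≤3 κ≢even with j ≟ m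
  ... | yes _ = ≤-refl
  ... | no  _ = bodyColor≤3 κ j κ≢even

  cycleColor≡3 : cycleColor m κ j ≡ 3 → j ≡ m
  cycleColor≡3 eq with j ≟ m
  ... | yes j≡m = j≡m
  ... | no  _   = ⊥-elim (bodyColor≢3 κ j eq)

  cycleColor≡4 : cycleColor m κ j ≡ 4 → κ ≡ even × j ≡ 0
  cycleColor≡4 eq with j ≟ m
  ... | yes _ with () ← eq
  ... | no  _ = bodyColor≡4 κ j eq

  cycleColor≤2 : cycleColor m κ j ≤ 2 → j ≢ m × cycleColor m κ j ≡ bodyColor κ j
  cycleColor≤2 c≤2 with j ≟ m
  ... | yes _   = ⊥-elim (<⇒≱ ≤-refl c≤2)
  ... | no  j≢m = j≢m , refl

color-cases : ∀ {c} → c ≤ 4 → c ≤ 2 ⊎ c ≡ 3 ⊎ c ≡ 4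
color-cases {0} _ = inj₁ z≤n
color-cases {1} _ = inj₁ (s≤s z≤n)
color-cases {2} _ = inj₁ ≤-refl
color-cases {3} _ = inj₂ (inj₁ refl)
color-cases {4} _ = inj₂ (inj₂ refl)
color-cases {suc (suc (suc (suc (suc _))))} (s≤s (s≤s (s≤s (s≤s ()))))

necklaceColor : ∀ {c} s → Fin c × Fin (3 + 4 * s) → ℕ
necklaceColor s u = cycleColor (2 + 4 * s) (kind (copy u)) (pos u)

module _ {c : ℕ} (s : ℕ) (u : Fin c × Fin (3 + 4 * s)) where

  necklaceColor≡3 : necklaceColor s u ≡ 3 → pos u ≡ 2 + 4 * s
  necklaceColor≡3 = cycleColor≡3 (2 + 4 * s) (kind (copy u)) (pos u)

  necklaceColor≡4 : necklaceColor s u ≡ 4 → kind (copy u) ≡ even × pos u ≡ 0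
  necklaceColor≡4 = cycleColor≡4 (2 + 4 * s) (kind (copy u)) (pos u)

  necklaceColor≤2 : necklaceColor s u ≤ 2 → pos u < 2 + 4 * s × necklaceColor s u ≡ bodyColor (kind (copy u)) (pos u)
  necklaceColor≤2 c≤2 with cycleColor≤2 (2 + 4 * s) (kind (copy u)) (pos u) c≤2
  ... | u≢last , cu = ≤∧≢⇒< (≤-pred (toℕ<n (proj₂ u))) u≢last , cu

seam-table : ∀ {e q d b} → e ≤ 1 → q ≤ 1 → q + d ≡ 3 + b → d ≤ suc (stripe (e + q)) →
             stripe (e + q) ≢ stripe (e + b)
seam-table {0} {0}             _ _ refl (s≤s ())
seam-table {0} {1} {b = 0}     _ _ refl _ ()
seam-table {0} {1} {b = suc _} _ _ refl (s≤s (s≤s ()))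
seam-table {1} {0}             _ _ refl (s≤s (s≤s ()))
seam-table {1} {1}             _ _ refl (s≤s ())
seam-table {suc (suc _)}       (s≤s ())
seam-table {q = suc (suc _)}   _ (s≤s ())

-- A conflict across the seam starts at 4s or 4s + 1, which stripe colours like 0 or 1.
stripe-seam-separated : ∀ s {e a b d} → e ≤ 1 → a < 2 + 4 * s → a + d ≡ b + (3 + 4 * s) →
                        d ≤ suc (stripe (e + a)) → stripe (e + a) ≢ stripe (e + b)
stripe-seam-separated s {e} {a} {b} {d} e≤1 a<m wrap d≤ with m≤n⇒∃[o]m+o≡n (+-cancelʳ-≤ 3 (4 * s) a 4s+3≤a+3)
  where
  4s+3≤a+3 : 4 * s + 3 ≤ a + 3
  4s+3≤a+3 = begin
    4 * s + 3       ≡⟨ +-comm (4 * s) 3 ⟩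
    3 + 4 * s       ≤⟨ m≤n+m (3 + 4 * s) b ⟩
    b + (3 + 4 * s) ≡⟨ sym wrap ⟩
    a + d           ≤⟨ +-monoʳ-≤ a (≤-trans d≤ (s≤s (stripe≤2 (e + a)))) ⟩
    a + 3           ∎
    where open ≤-Reasoning
... | q , refl = seam-table e≤1 q≤1 q+d≡3+b (subst (λ x → d ≤ suc x) periodic d≤) ∘ trans (sym periodic)
  where
  q≤1 : q ≤ 1
  q≤1 = ≤-pred (+-cancelˡ-≤ (4 * s) (suc q) 2
          (subst₂ _≤_ (sym (+-suc (4 * s) q)) (+-comm 2 (4 * s)) a<m))
  q+d≡3+b : q + d ≡ 3 + b
  q+d≡3+b = +-cancelˡ-≡ (4 * s) (q + d) (3 + b) (begin
    4 * s + (q + d) ≡⟨ sym (+-assoc (4 * s) q d) ⟩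
    4 * s + q + d   ≡⟨ wrap ⟩
    b + (3 + 4 * s) ≡⟨ +-comm b (3 + 4 * s) ⟩
    3 + 4 * s + b   ≡⟨ cong (_+ b) (+-comm 3 (4 * s)) ⟩
    4 * s + 3 + b   ≡⟨ +-assoc (4 * s) 3 b ⟩
    4 * s + (3 + b) ∎)
    where open ≡-Reasoning
  periodic : stripe (e + (4 * s + q)) ≡ stripe (e + q)
  periodic = trans (cong stripe (x∙yz≈y∙xz e (4 * s) q)) (stripe-periodic s (e + q))

stripe-arc-separated : ∀ s {e a b d} → e ≤ 1 → a < 2 + 4 * s → 1 ≤ d → Arc (3 + 4 * s) d a b →
                       d ≤ suc (stripe (e + a)) → stripe (e + a) ≢ stripe (e + b)
stripe-arc-separated s {e} {a} {d = d} _ _ 1≤d (inj₁ refl) d≤ same =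
  stripe-separated (e + a) d 1≤d d≤ (trans same (cong stripe (sym (+-assoc e a d))))
stripe-arc-separated s e≤1 a<m _ (inj₂ wrap) d≤ = stripe-seam-separated s e≤1 a<m wrap d≤

stripe-cycle-packing : ∀ s {e a b k} → e ≤ 1 → a < 2 + 4 * s → b < 2 + 4 * s → stripe (e + a) ≡ stripe (e + b) →
                       k ≤ suc (stripe (e + a)) → CycleDist≤ (3 + 4 * s) k a b → a ≡ b
stripe-cycle-packing s {e} {a} {b} {k} e≤1 a<m b<m same k≤ dist
  with cycleDist-arc (m≤n⇒m≤1+n a<m) (m≤n⇒m≤1+n b<m)
                     (≤-trans k≤ (≤-trans (s≤s (stripe≤2 (e + a))) (m≤m+n 3 (4 * s)))) dist
... | zero  , _   , inj₁ arc = arc-zero (m≤n⇒m≤1+n a<m) arc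
... | zero  , _   , inj₂ arc = sym (arc-zero (m≤n⇒m≤1+n b<m) arc)
... | suc d , d<k , inj₁ arc = ⊥-elim (stripe-arc-separated s e≤1 a<m (s≤s z≤n) arc (≤-trans d<k k≤) same)
... | suc d , d<k , inj₂ arc =
  ⊥-elim (stripe-arc-separated s e≤1 b<m (s≤s z≤n) arc (≤-trans d<k (subst (λ x → k ≤ suc x) same k≤)) (sym same))

cycleColor-packing : ∀ s κ {a b k} → a < 3 + 4 * s → b < 3 + 4 * s →
                     cycleColor (2 + 4 * s) κ a ≡ cycleColor (2 + 4 * s) κ b →
                     k ≤ suc (cycleColor (2 + 4 * s) κ a) → CycleDist≤ (3 + 4 * s) k a b → a ≡ b
cycleColor-packing s κ {a} {b} {k} a<n b<n same k≤ dist with color-cases (cycleColor≤4 (2 + 4 * s) κ a)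
... | inj₂ (inj₁ c≡3) = trans (cycleColor≡3 _ κ a c≡3) (sym (cycleColor≡3 _ κ b (trans (sym same) c≡3)))
... | inj₂ (inj₂ c≡4) =
  trans (proj₂ (cycleColor≡4 _ κ a c≡4)) (sym (proj₂ (cycleColor≡4 _ κ b (trans (sym same) c≡4))))
... | inj₁ c≤2 with cycleColor≤2 _ κ a c≤2 | cycleColor≤2 _ κ b (subst (_≤ 2) same c≤2)
...   | a≢m , ca | b≢m , cb =
  stripe-cycle-packing s (shift≤1 κ) (≤∧≢⇒< (≤-pred a<n) a≢m) (≤∧≢⇒< (≤-pred b<n) b≢m)
    (trans (sym sa) (trans same sb)) (subst (λ x → k ≤ suc x) sa k≤) dist
  where
  sa = trans ca (bodyColor≤2 κ a (subst (_≤ 2) ca c≤2))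
  sb = trans cb (bodyColor≤2 κ b (subst (_≤ 2) cb (subst (_≤ 2) same c≤2)))

exit-arc : ∀ {n a d} → 5 ≤ n → a < n → d ≤ 2 → Arc n d a 2 ⊎ Arc n d 2 a → d + a ≡ 2 ⊎ 2 + d ≡ a
exit-arc {a = a} {d} _ _ _ (inj₁ (inj₁ a+d≡2)) = inj₁ (trans (+-comm d a) a+d≡2)
exit-arc {n} {a} {d} _ a<n d≤2 (inj₁ (inj₂ a+d≡2+n)) =
  ⊥-elim (<⇒≱ a<n (+-cancelˡ-≤ 2 n a (≤-trans (≤-reflexive (sym a+d≡2+n))
                                              (≤-trans (+-monoʳ-≤ a d≤2) (≤-reflexive (+-comm a 2))))))
exit-arc _ _ _ (inj₂ (inj₁ 2+d≡a)) = inj₂ 2+d≡a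
exit-arc {n} {a} 5≤n _ d≤2 (inj₂ (inj₂ 2+d≡a+n)) =
  ⊥-elim (<⇒≱ (s≤s (+-monoʳ-≤ 2 d≤2)) (≤-trans 5≤n (≤-trans (m≤n+m n a) (≤-reflexive (sym 2+d≡a+n)))))

exit<5 : ∀ {d a} → d ≤ 2 → d + a ≡ 2 ⊎ 2 + d ≡ a → a < 5
exit<5 {d} {a} _ (inj₁ d+a≡2) = ≤-trans (s≤s (≤-trans (m≤n+m a d) (≤-reflexive d+a≡2))) (m≤n+m 3 2)
exit<5 d≤2 (inj₂ refl) = s≤s (s≤s (s≤s d≤2))

entry-arc : ∀ {n b d} → d < n → Arc n d 0 b ⊎ Arc n d b 0 → d ≡ b ⊎ b + d ≡ n
entry-arc _ (inj₁ (inj₁ d≡b)) = inj₁ d≡b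
entry-arc {n} {b} d<n (inj₁ (inj₂ d≡b+n)) = ⊥-elim (<⇒≱ d<n (≤-trans (m≤n+m n b) (≤-reflexive (sym d≡b+n))))
entry-arc {b = b} _ (inj₂ (inj₁ b+d≡0)) = inj₁ (trans (m+n≡0⇒n≡0 b b+d≡0) (sym (m+n≡0⇒m≡0 b b+d≡0)))
entry-arc _ (inj₂ (inj₂ b+d≡n)) = inj₂ b+d≡n

entry-over-seam : ∀ s {b d₁ d₂} → b < 2 + 4 * s → b + d₂ ≡ 3 + 4 * s → d₁ + d₂ ≤ 2 →
                  d₁ ≡ 0 × d₂ ≡ 2 × b ≡ 4 * s + 1
entry-over-seam s {b} {d₁} {d₂} b<m wrap d≤2 = n≤0⇒n≡0 d₁≤0 , d₂≡2 , b≡4s+1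
  where
  d₂≡2 : d₂ ≡ 2
  d₂≡2 = ≤-antisym (m+n≤o⇒n≤o d₁ d≤2)
    (+-cancelˡ-≤ b 2 d₂ (≤-trans (≤-reflexive (+-comm b 2)) (≤-trans (s≤s b<m) (≤-reflexive (sym wrap)))))
  d₁≤0 : d₁ ≤ 0
  d₁≤0 = +-cancelʳ-≤ 2 d₁ 0 (subst (λ x → d₁ + x ≤ 2) d₂≡2 d≤2)
  b≡4s+1 : b ≡ 4 * s + 1
  b≡4s+1 = +-cancelʳ-≡ 2 b (4 * s + 1)
    (trans (cong (b +_) (sym d₂≡2)) (trans wrap (trans (+-comm 3 (4 * s)) (sym (+-assoc (4 * s) 1 2)))))

-- a lies d steps from the last path vertex 2 of a copy of kind κ, and b lies b steps from
-- the first path vertex 0 of the next copy.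
BridgeSeparated : Kind → ℕ → ℕ → ℕ → Set
BridgeSeparated κ d a b = d + a ≡ 2 ⊎ 2 + d ≡ a → d + b ≤ bodyColor κ a → bodyColor κ a ≢ bodyColor (following κ) b

bridge-table? : ∀ κ → Dec (∀ {d} → d < 3 → ∀ {a} → a < 5 → ∀ {b} → b < 3 → BridgeSeparated κ d a b)
bridge-table? κ = allUpTo? (λ d → allUpTo? (λ a → allUpTo? (λ b →
  (d + a ≟ 2 ⊎-dec 2 + d ≟ a) →-dec
  (d + b ≤? bodyColor κ a →-dec ¬? (bodyColor κ a ≟ bodyColor (following κ) b))) 3) 5) 3

bridge-table : ∀ κ {d} → d < 3 → ∀ {a} → a < 5 → ∀ {b} → b < 3 → BridgeSeparated κ d a b
bridge-table initial = from-yes (bridge-table? initial)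
bridge-table odd     = from-yes (bridge-table? odd)
bridge-table even    = from-yes (bridge-table? even)

3≤3*suc : ∀ g → 3 ≤ 3 * suc g
3≤3*suc g = ≤-trans (m≤m+n 3 (3 * g)) (≤-reflexive (sym (*-suc 3 g)))

module _ (s : ℕ) (1≤s : 1 ≤ s) where

  private
    ≤n : ∀ {x} → x ≤ 7 → x ≤ 3 + 4 * s
    ≤n x≤7 = ≤-trans x≤7 (+-monoʳ-≤ 3 (*-monoʳ-≤ 4 1≤s))

  bridge-arcs-separated : ∀ κ {a b d₁ d₂} → b < 2 + 4 * s →
                          d₁ + a ≡ 2 ⊎ 2 + d₁ ≡ a → d₂ ≡ b ⊎ b + d₂ ≡ 3 + 4 * s →
                          d₁ + d₂ ≤ bodyColor κ a → bodyColor κ a ≤ 2 → bodyColor κ a ≢ bodyColor (following κ) b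
  bridge-arcs-separated κ {d₁ = d₁} _ exit (inj₁ refl) d≤c c≤2 =
    bridge-table κ (s≤s d₁≤2) (exit<5 d₁≤2 exit) (s≤s (m+n≤o⇒n≤o d₁ d≤2)) exit d≤c
    where
    d≤2 = ≤-trans d≤c c≤2
    d₁≤2 = m+n≤o⇒m≤o d₁ d≤2
  -- Reached from 0 backwards over the last vertex, b = 4s + 1 is coloured like vertex 1.
  bridge-arcs-separated κ b<m exit (inj₂ wrap) d≤c c≤2 with entry-over-seam s b<m wrap (≤-trans d≤c c≤2)
  ... | refl , refl , refl =
    bridge-table κ (s≤s z≤n) (exit<5 z≤n exit) (s≤s (s≤s z≤n)) exit (≤-trans (n≤1+n 1) d≤c)
    ∘ flip trans (bodyColor-periodic (following κ) s (s≤s z≤n))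

  bridge-separated : ∀ κ {a b k₁ k₂} → a < 2 + 4 * s → b < 2 + 4 * s →
                     CycleDist≤ (3 + 4 * s) k₁ a 2 → CycleDist≤ (3 + 4 * s) k₂ 0 b →
                     k₁ + k₂ ≤ bodyColor κ a → bodyColor κ a ≤ 2 → bodyColor κ a ≢ bodyColor (following κ) b
  bridge-separated κ {a} {b} {k₁} {k₂} a<m b<m dist₁ dist₂ k≤c c≤2
    with cycleDist-arc (m≤n⇒m≤1+n a<m) (≤n (m≤m+n 3 4)) (≤n (≤-trans (m+n≤o⇒m≤o k₁ k≤2) (m≤m+n 2 5))) dist₁
       | cycleDist-arc (≤n (m≤m+n 1 6)) (m≤n⇒m≤1+n b<m) (≤n (≤-trans (m+n≤o⇒n≤o k₁ k≤2) (m≤m+n 2 5))) dist₂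
    where k≤2 = ≤-trans k≤c c≤2
  ... | d₁ , d₁≤k₁ , arc₁ | d₂ , d₂≤k₂ , arc₂ =
    bridge-arcs-separated κ b<m
      (exit-arc (≤n (m≤m+n 5 2)) (m≤n⇒m≤1+n a<m) (m+n≤o⇒m≤o d₁ d≤2) arc₁)
      (entry-arc (≤n (≤-trans (s≤s (m+n≤o⇒n≤o d₁ d≤2)) (m≤m+n 3 4))) arc₂) d≤c c≤2
    where
    d≤c = ≤-trans (+-mono-≤ d₁≤k₁ d₂≤k₂) k≤c
    d≤2 = ≤-trans d≤c c≤2

  across-from-last : ∀ {g k k₁ k₂ a b} → a ≡ 2 + 4 * s → b ≡ 2 + 4 * s → k₁ + suc (3 * g + k₂) ≤ k →
                     CycleDist≤ (3 + 4 * s) k₁ a 2 → CycleDist≤ (3 + 4 * s) k₂ 0 b → 5 ≤ k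
  across-from-last {g} {k₁ = k₁} {k₂} refl refl len dist₁ dist₂ =
    ≤-trans (+-mono-≤ 3≤k₁ (s≤s (≤-trans 1≤k₂ (m≤n+m k₂ (3 * g))))) len
    where
    3≤k₁ : 3 ≤ k₁
    3≤k₁ = cycleDist-≥ ≤-refl (+-monoʳ-≤ 2 (≤-trans (n≤1+n 3) (*-monoʳ-≤ 4 1≤s)))
                       (≤-reflexive (+-comm (2 + 4 * s) 3)) (cycleDist-sym {3 + 4 * s} dist₁)
    1≤k₂ : 1 ≤ k₂
    1≤k₂ = cycleDist-≥ ≤-refl (s≤s z≤n) (≤-reflexive (+-comm (2 + 4 * s) 1)) dist₂

  across-twice-from-first : ∀ {g k k₁ k₂} → k₁ + suc (3 * suc g + k₂) ≤ k →
                            CycleDist≤ (3 + 4 * s) k₁ 0 2 → 6 ≤ k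
  across-twice-from-first {g} {k₁ = k₁} {k₂} len dist₁ =
    ≤-trans (+-mono-≤ 2≤k₁ (s≤s (≤-trans (3≤3*suc g) (m≤m+n _ k₂)))) len
    where
    2≤k₁ : 2 ≤ k₁
    2≤k₁ = cycleDist-≥ (≤n (m≤m+n 3 4)) ≤-refl (≤n (m≤m+n 4 3)) dist₁

  packing-adjacent-copies : ∀ {c k} {u v : Fin c × Fin (3 + 4 * s)} → copy v ≡ suc (copy u) →
                            necklaceColor s u ≡ necklaceColor s v → k ≤ suc (necklaceColor s u) →
                            Walk (Necklace c (3 + 4 * s)) k u v → ⊥
  packing-adjacent-copies {k = k} {u} {v} v~u same k≤ ws
    with walk-across (≤n (m≤m+n 4 3)) 0 v~u ws | color-cases (cycleColor≤4 (2 + 4 * s) (kind (copy u)) (pos u))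
  ... | k₁ , k₂ , len , dist₁ , dist₂ | inj₂ (inj₁ c≡3) =
    <⇒≱ (across-from-last {g = 0} (necklaceColor≡3 s u c≡3) (necklaceColor≡3 s v (trans (sym same) c≡3))
                          len dist₁ dist₂)
        (subst (λ x → k ≤ suc x) c≡3 k≤)
  ... | _ | inj₂ (inj₂ c≡4) =
    following-even (proj₁ (necklaceColor≡4 s u c≡4))
                   (trans (sym (cong kind v~u)) (proj₁ (necklaceColor≡4 s v (trans (sym same) c≡4))))
  ... | k₁ , k₂ , len , dist₁ , dist₂ | inj₁ c≤2
    with necklaceColor≤2 s u c≤2 | necklaceColor≤2 s v (subst (_≤ 2) same c≤2)
  ...   | a<m , ca | b<m , cb =
    bridge-separated (kind (copy u)) a<m b<m dist₁ dist₂ (subst (k₁ + k₂ ≤_) ca k≤c) (subst (_≤ 2) ca c≤2)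
      (trans (sym ca) (trans same (trans cb (cong (λ i → bodyColor (kind i) (pos v)) v~u))))
    where
    k≤c : k₁ + k₂ ≤ necklaceColor s u
    k≤c = ≤-pred (≤-trans (≤-reflexive (sym (+-suc k₁ k₂))) (≤-trans len k≤))

  packing-distant-copies : ∀ {c} g {k} {u v : Fin c × Fin (3 + 4 * s)} → copy v ≡ suc (suc g + copy u) →
                           necklaceColor s u ≡ necklaceColor s v → k ≤ suc (necklaceColor s u) →
                           Walk (Necklace c (3 + 4 * s)) k u v → ⊥
  packing-distant-copies g {k} {u} {v} v~u same k≤ ws
    with walk-across (≤n (m≤m+n 4 3)) (suc g) v~u ws | color-cases (cycleColor≤4 (2 + 4 * s) (kind (copy u)) (pos u))
  ... | k₁ , k₂ , len , _ , _ | inj₁ c≤2 =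
    <⇒≱ (≤-trans (≤-trans (s≤s (≤-trans (3≤3*suc g) (m≤m+n _ k₂))) (m≤n+m _ k₁)) len)
        (≤-trans k≤ (s≤s c≤2))
  ... | k₁ , k₂ , len , dist₁ , dist₂ | inj₂ (inj₁ c≡3) =
    <⇒≱ (across-from-last {g = suc g} (necklaceColor≡3 s u c≡3) (necklaceColor≡3 s v (trans (sym same) c≡3))
                          len dist₁ dist₂)
        (subst (λ x → k ≤ suc x) c≡3 k≤)
  ... | k₁ , k₂ , len , dist₁ , _ | inj₂ (inj₂ c≡4) =
    <⇒≱ (across-twice-from-first {g = g} len
           (subst (λ x → CycleDist≤ (3 + 4 * s) k₁ x 2) (proj₂ (necklaceColor≡4 s u c≡4)) dist₁))
        (subst (λ x → k ≤ suc x) c≡4 k≤)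

  packing-different-copies : ∀ {c k} {u v : Fin c × Fin (3 + 4 * s)} → copy u < copy v →
                             necklaceColor s u ≡ necklaceColor s v → k ≤ suc (necklaceColor s u) →
                             Walk (Necklace c (3 + 4 * s)) k u v → ⊥
  packing-different-copies {u = u} u<v with m≤n⇒∃[o]m+o≡n u<v
  ... | zero  , eq = packing-adjacent-copies (sym (trans (sym (+-identityʳ _)) eq))
  ... | suc g , eq = packing-distant-copies g (sym (trans (cong suc (+-comm (suc g) (copy u))) eq))

  necklaceColor-packing : ∀ {c k} {u v : Fin c × Fin (3 + 4 * s)} → u ≢ v →
                          necklaceColor s u ≡ necklaceColor s v → k ≤ suc (necklaceColor s u) →
                          Walk (Necklace c (3 + 4 * s)) k u v → ⊥
  necklaceColor-packing {k = k} {u} {v} u≢v same k≤ ws with <-cmp (copy u) (copy v)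
  ... | tri< u<v _ _ = packing-different-copies u<v same k≤ ws
  ... | tri> _ _ v<u =
    packing-different-copies v<u (sym same) (subst (λ x → k ≤ suc x) same k≤) (walk-reverse diamondAdj-sym ws)
  ... | tri≈ _ u~v _ =
    u≢v (cong₂ _,_ (toℕ-injective u~v)
                   (toℕ-injective (cycleColor-packing s (kind (copy u)) (toℕ<n (proj₂ u)) (toℕ<n (proj₂ v))
                                    (trans same (cong (λ i → cycleColor (2 + 4 * s) (kind i) (pos v)) (sym u~v))) k≤
                                    (walk-in-copy (≤n (m≤m+n 3 4)) u~v ws))))

colorable-from-ℕ : ∀ {G k} (col : V G → ℕ) → (∀ u → col u < k) →
                   (∀ {j u v} → u ≢ v → col u ≡ col v → j ≤ suc (col u) → Walk G j u v → ⊥) →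
                   PackingColorable G k
colorable-from-ℕ col col<k separated = (λ u → fromℕ< (col<k u)) , λ u v u≢v same (j , j≤ , ws) →
  separated u≢v (trans (sym (toℕ-fromℕ< (col<k u))) (trans (cong toℕ same) (toℕ-fromℕ< (col<k v))))
                (subst (λ x → j ≤ suc x) (toℕ-fromℕ< (col<k u)) j≤) ws

3*t/3≡t : ∀ t → 3 * t / 3 ≡ t
3*t/3≡t t = trans (cong (_/ 3) (*-comm 3 t)) (m*n/n≡m t 3)

theorem13 : (s t : ℕ) → 1 ≤ s → 1 ≤ t →
    ((t ≤ 2 → PackingColorable (PDiamondC (3 * t) 3 (3 + 4 * s)) 4)
    × (3 ≤ t → PackingColorable (PDiamondC (3 * t) 3 (3 + 4 * s)) 5))
    × (t ≤ 2 → PackingChromaticNumber (PDiamondC (3 * t) 3 (3 + 4 * s)) 4)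
theorem13 s t 1≤s 1≤t =
  (four-colorable , λ _ → five-colorable) , λ t≤2 → four-colorable t≤2 , λ j j<4 → not-three-colorable (≤-pred j<4)
  where
  five-colorable : PackingColorable (PDiamondC (3 * t) 3 (3 + 4 * s)) 5
  five-colorable = colorable-from-ℕ (necklaceColor s)
    (λ (i , j) → s≤s (cycleColor≤4 _ (kind (toℕ i)) (toℕ j)))
    (necklaceColor-packing s 1≤s)

  four-colorable : t ≤ 2 → PackingColorable (PDiamondC (3 * t) 3 (3 + 4 * s)) 4
  four-colorable t≤2 = colorable-from-ℕ (necklaceColor s)
    (λ (i , j) → s≤s (cycleColor≤3 _ (kind (toℕ i)) (toℕ j)
                        (early-kind≢even (≤-trans (toℕ<n i) (≤-trans (≤-reflexive (3*t/3≡t t)) t≤2)))))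
    (necklaceColor-packing s 1≤s)

  not-three-colorable : ∀ {j} → j ≤ 3 → ¬ PackingColorable (PDiamondC (3 * t) 3 (3 + 4 * s)) j
  not-three-colorable = odd-necklace-not-3-colorable (1 + 2 * s) (odd-length s) (s≤s (≤-trans 1≤s (m≤m+n s _)))
                          (subst Fin (sym (3*t/3≡t t)) (fromℕ< 1≤t))
    where
    odd-length : ∀ s → 3 + 4 * s ≡ suc ((1 + 2 * s) * 2)
    odd-length = solve-∀
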